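{- Let $k\in\mathbb{Z}$. For every $n\in\mathbb{N}$ (i.e. $n\ge1$), $$E_{n-1}^{(k)}(x)=\frac{1}{n}\sum_{j=1}^{n}\sum_{m=1}^{j}\binom{n}{j}\frac{S_{1}(j,m)}{m^{k-1}}E_{n-j}(x).$$
   Context: The Euler polynomials $E_n(x)$ are defined by $\frac{2}{e^t+1}e^{xt}=\sum_{n=0}^\infty E_n(x)\frac{t^n}{n!}$. For $k\in\mathbb{Z}$, $\mathrm{Ei}_k(x)=\sum_{n=1}^{\infty}\frac{x^n}{n^k (n-1)!}$; the poly-Genocchi polynomials $G_n^{(k)}(x)$ are defined by $\frac{2\,\mathrm{Ei}_k(\log(1+t))}{e^t+1}e^{xt}=\sum_{n=0}^{\infty}G_n^{(k)}(x)\frac{t^n}{n!}$, and the poly-Euler polynomials by $E_n^{(k)}(x)=\frac{G_{n+1}^{(k)}(x)}{n+1}$ ($n\ge0$). $S_1(n,m)$ are the signed Stirling numbers of the first kind: $\frac{(\log(1+t))^m}{m!}=\sum_{n\ge m}S_1(n,m)\frac{t^n}{n!}$. -}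

module Defs where

open import Data.Nat as ℕ using (ℕ; zero; suc; _!; _∸_)
open import Data.Nat.Properties using (_!≢0; m^n≢0)
open import Data.Integer as ℤ using (ℤ; +_; -[1+_])
open import Data.Rational using (ℚ; _+_; _*_; _-_; -_; 0ℚ; 1ℚ; ½; _/_)
open import Data.List using (List; []; _∷_)

-- Formal power series over ℚ, represented by their (ordinary)
-- coefficient functions:  f = Σ_n f n · t^n.

Series : Set
Series = ℕ → ℚ

sumFrom : ℕ → ℕ → (ℕ → ℚ) → ℚ
sumFrom a zero    f = 0ℚ
sumFrom a (suc l) f = f a + sumFrom (suc a) l f

-- Σ_{i=a}^{b} f i   (empty, i.e. 0, when b < a)
sumRange : ℕ → ℕ → (ℕ → ℚ) → ℚ
sumRange a b f = sumFrom a (suc b ∸ a) f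

nat : ℕ → ℚ
nat n = (+ n) / 1

invFact : ℕ → ℚ
invFact n = _/_ (+ 1) (n !) {{n !≢0}}

_^ℚ_ : ℚ → ℕ → ℚ
x ^ℚ zero  = 1ℚ
x ^ℚ suc n = x * (x ^ℚ n)

-- recipPow m k = 1 / m^k  for m ≥ 1 and k ∈ ℤ
-- (value at m = 0 is an irrelevant junk value 0; it is never used)
recipPow : ℕ → ℤ → ℚ
recipPow zero    _        = 0ℚ
recipPow (suc m) (+ n)    = _/_ (+ 1) (suc m ℕ.^ n) {{m^n≢0 (suc m) n}}
recipPow (suc m) -[1+ n ] = (+ (suc m ℕ.^ suc n)) / 1

const : ℚ → Series
const c zero    = c
const c (suc _) = 0ℚ

_⊕_ : Series → Series → Series
(f ⊕ g) n = f n + g n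

_⊛_ : Series → Series → Series
(f ⊛ g) n = sumRange 0 n (λ i → f i * g (n ∸ i))

_^ₛ_ : Series → ℕ → Series
f ^ₛ zero  = const 1ℚ
f ^ₛ suc m = f ⊛ (f ^ₛ m)

-- quotient num / den of series, where c is the inverse of den 0.
-- divRev c num den n = [q n, q (n-1), …, q 0] with q · den = num.
lookupD : List ℚ → ℕ → ℚ
lookupD []       _       = 0ℚ
lookupD (x ∷ xs) zero    = x
lookupD (x ∷ xs) (suc i) = lookupD xs i

divRev : ℚ → Series → Series → ℕ → List ℚ
divRev c num den zero    = (c * num 0) ∷ []
divRev c num den (suc n) =
  let bs = divRev c num den n in
  (c * (num (suc n) - sumFrom 0 (suc n) (λ j → den (suc j) * lookupD bs j))) ∷ bs

divSeries : ℚ → Series → Series → Series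
divSeries c num den n = lookupD (divRev c num den n) 0

expS : ℚ → Series
expS x n = (x ^ℚ n) * invFact n

logS : Series
logS zero    = 0ℚ
logS (suc n) = ((- 1ℚ) ^ℚ n) * ((+ 1) / suc n)

-- composition  F(u) for F = Σ_{m ≥ 0} a m X^m and a series u with u 0 = 0:
-- only m ≤ n contribute to the coefficient of t^n.
compose : Series → Series → Series
compose a u n = sumRange 0 n (λ m → a m * (u ^ₛ m) n)

EiCoeff : ℤ → Series
EiCoeff k zero    = 0ℚ
EiCoeff k (suc m) = recipPow (suc m) k * invFact m

eulerGF : Series
eulerGF = divSeries ½ (const (nat 2)) (expS 1ℚ ⊕ const 1ℚ)

-- Euler polynomials, evaluated at x ∈ ℚ:
--   2 e^{xt} / (e^t + 1) = Σ E n x · t^n / n!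
E : ℕ → ℚ → ℚ
E n x = nat (n !) * (eulerGF ⊛ expS x) n

-- poly-Genocchi polynomials, evaluated at x ∈ ℚ:
--   2 Ei_k(log(1+t)) e^{xt} / (e^t + 1) = Σ G k n x · t^n / n!
G : ℤ → ℕ → ℚ → ℚ
G k n x = nat (n !) * ((compose (EiCoeff k) logS ⊛ eulerGF) ⊛ expS x) n

polyE : ℤ → ℕ → ℚ → ℚ
polyE k n x = G k (suc n) x * ((+ 1) / suc n)

-- signed Stirling numbers of the first kind:
--   (log(1+t))^m / m! = Σ_{n ≥ m} S₁ n m · t^n / n!
S₁ : ℕ → ℕ → ℚ
S₁ n m = nat (n !) * invFact m * (logS ^ₛ m) n

-- Reassociating the Cauchy product gives G_n = n! Σ_j [t^j] Ei_k(log(1+t)) · [t^(n-j)] 2e^(xt)/(e^t+1).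
-- Expanding Ei_k(log(1+t)) = Σ_m log(1+t)^m · m^(1-k)/m! and splitting n! = C(n,j) j! (n-j)!
-- turns each term into C(n,j) S₁(j,m) m^(1-k) E_(n-j)(x); the terms with j = 0 or m = 0 vanish
-- because Ei_k has no constant term, and dividing by n gives E_(n-1)^(k).
module Submission where

open import Defs
open import Data.Nat using (ℕ; _∸_; NonZero)
open import Data.Nat.Combinatorics using (_C_)
open import Data.Integer using (ℤ; +_) renaming (_-_ to _-ℤ_)
open import Data.Rational using (ℚ; _*_; _/_)
open import Relation.Binary.PropositionalEquality using (_≡_)

open import Data.Nat as ℕ using (zero; suc; _!; _≤_; _<_; s≤s; s≤s⁻¹; z≤n)
import Data.Nat.Properties as ℕP
open import Data.Nat.Combinatorics using (nCk≡n!/k![n-k]!; k![n∸k]!∣n!)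
open import Data.Nat.DivMod using (m/n*n≡m)
open import Data.Nat.Tactic.RingSolver using (solve-∀)
open import Data.Integer using (-[1+_])
import Data.Integer.Properties as ℤP
open import Data.Rational using (_+_; 0ℚ; toℚᵘ)
open import Data.Rational.Properties
  using (*-comm; *-assoc; *-zeroˡ; *-zeroʳ; +-assoc; +-identityˡ; +-identityʳ; *-distribˡ-+; *-distribʳ-+;
         toℚᵘ-injective; toℚᵘ-homo-*; toℚᵘ-fromℚᵘ; fromℚᵘ-cong)
import Data.Rational.Unnormalised as ℚᵘ
import Data.Rational.Unnormalised.Properties as ℚᵘP
open import Data.Rational.Solver using (module +-*-Solver)
open +-*-Solver using (solve; _:+_; _:*_; _:=_)
open import Relation.Binary.PropositionalEquality using (refl; sym; trans; cong; cong₂; subst; module ≡-Reasoning)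

/-*-/ : ∀ i j a b .{{_ : NonZero a}} .{{_ : NonZero b}} →
  (+ i / a) * (+ j / b) ≡ (+ (i ℕ.* j) / (a ℕ.* b)) {{ℕP.m*n≢0 a b}}
/-*-/ i j (suc a) (suc b) = toℚᵘ-injective (begin
    toℚᵘ (+ i / suc a * (+ j / suc b))
  ≈⟨ toℚᵘ-homo-* (+ i / suc a) (+ j / suc b) ⟩
    toℚᵘ (+ i / suc a) ℚᵘ.* toℚᵘ (+ j / suc b)
  ≈⟨ ℚᵘP.*-cong (toℚᵘ-fromℚᵘ (ℚᵘ.mkℚᵘ (+ i) a)) (toℚᵘ-fromℚᵘ (ℚᵘ.mkℚᵘ (+ j) b)) ⟩
    ℚᵘ.mkℚᵘ (+ i ℤ* + j) (ℕ.pred (suc a ℕ.* suc b))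
  ≡⟨ cong (λ z → ℚᵘ.mkℚᵘ z _) (sym (ℤP.pos-* i j)) ⟩
    ℚᵘ.mkℚᵘ (+ (i ℕ.* j)) (ℕ.pred (suc a ℕ.* suc b))
  ≈⟨ ℚᵘP.≃-sym (toℚᵘ-fromℚᵘ _) ⟩
    toℚᵘ (+ (i ℕ.* j) / (suc a ℕ.* suc b))
  ∎)
  where
  open ℚᵘP.≃-Reasoning
  open import Data.Integer using () renaming (_*_ to _ℤ*_)

/-≡-/ : ∀ i j a b .{{_ : NonZero a}} .{{_ : NonZero b}} →
  i ℕ.* b ≡ j ℕ.* a → + i / a ≡ + j / b
/-≡-/ i j (suc a) (suc b) eq =
  fromℚᵘ-cong {ℚᵘ.mkℚᵘ (+ i) a} {ℚᵘ.mkℚᵘ (+ j) b} (ℚᵘ.*≡* (trans (sym (ℤP.pos-* i (suc b))) (trans (cong +_ eq) (ℤP.pos-* j (suc a)))))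

nat-* : ∀ a b → nat a * nat b ≡ nat (a ℕ.* b)
nat-* a b = /-*-/ a b 1 1

nat-*-comm : ∀ a b → nat a * nat b ≡ nat (b ℕ.* a)
nat-*-comm a b = trans (nat-* a b) (cong nat (ℕP.*-comm a b))

nat-*-1/ : ∀ a b .{{_ : NonZero a}} .{{_ : NonZero b}} →
  nat a * ((+ 1) / (a ℕ.* b)) {{ℕP.m*n≢0 a b}} ≡ (+ 1) / b
nat-*-1/ a b = trans (/-*-/ a 1 1 (a ℕ.* b) {{_}} {{ℕP.m*n≢0 a b}})
  (/-≡-/ (a ℕ.* 1) 1 (1 ℕ.* (a ℕ.* b)) b {{ℕP.m*n≢0 1 (a ℕ.* b) {{_}} {{ℕP.m*n≢0 a b}}}}
    (cross a b))
  where
  cross : ∀ a b → a ℕ.* 1 ℕ.* b ≡ 1 ℕ.* (1 ℕ.* (a ℕ.* b))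
  cross = solve-∀

invFact-suc : ∀ m → invFact m ≡ nat (suc m) * invFact (suc m)
invFact-suc m = sym (nat-*-1/ (suc m) (m !) {{_}} {{m ℕP.!≢0}})

recipPow-*-suc : ∀ m k → recipPow (suc m) k * nat (suc m) ≡ recipPow (suc m) (k -ℤ + 1)
recipPow-*-suc m (+ zero)   = nat-*-comm 1 (suc m)
recipPow-*-suc m (+ suc n)  =
  trans (*-comm (recipPow (suc m) (+ suc n)) (nat (suc m)))
        (nat-*-1/ (suc m) (suc m ℕ.^ n) {{_}} {{ℕP.m^n≢0 (suc m) n}})
-- -[1+ n ] -ℤ + 1 normalises to -[1+ suc (n ℕ.+ 0) ], hence the +-identityʳ.
recipPow-*-suc m -[1+ n ]   =
  trans (nat-*-comm (suc m ℕ.^ suc n) (suc m))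
        (cong (λ e → nat (suc m ℕ.^ suc (suc e))) (sym (ℕP.+-identityʳ n)))

EiCoeff-suc : ∀ k m → EiCoeff k (suc m) ≡ invFact (suc m) * recipPow (suc m) (k -ℤ + 1)
EiCoeff-suc k m = begin
    recipPow (suc m) k * invFact m
  ≡⟨ cong (recipPow (suc m) k *_) (invFact-suc m) ⟩
    recipPow (suc m) k * (nat (suc m) * invFact (suc m))
  ≡⟨ sym (*-assoc (recipPow (suc m) k) _ _) ⟩
    recipPow (suc m) k * nat (suc m) * invFact (suc m)
  ≡⟨ cong (_* invFact (suc m)) (recipPow-*-suc m k) ⟩
    recipPow (suc m) (k -ℤ + 1) * invFact (suc m)
  ≡⟨ *-comm (recipPow (suc m) (k -ℤ + 1)) (invFact (suc m)) ⟩
    invFact (suc m) * recipPow (suc m) (k -ℤ + 1)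
  ∎
  where open ≡-Reasoning

nat-!≡C*!*! : ∀ n j → j ≤ n → nat (n !) ≡ nat (n C j) * nat (j !) * nat ((n ∸ j) !)
nat-!≡C*!*! n j j≤n = begin
    nat (n !)
  ≡⟨ cong nat (sym (trans (cong (ℕ._* (j ! ℕ.* (n ∸ j) !)) (nCk≡n!/k![n-k]! j≤n))
                          (m/n*n≡m (k![n∸k]!∣n! j≤n)))) ⟩
    nat ((n C j) ℕ.* (j ! ℕ.* (n ∸ j) !))
  ≡⟨ sym (nat-* (n C j) _) ⟩
    nat (n C j) * nat (j ! ℕ.* (n ∸ j) !)
  ≡⟨ cong (nat (n C j) *_) (sym (nat-* (j !) _)) ⟩
    nat (n C j) * (nat (j !) * nat ((n ∸ j) !))
  ≡⟨ sym (*-assoc (nat (n C j)) (nat (j !)) (nat ((n ∸ j) !))) ⟩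
    nat (n C j) * nat (j !) * nat ((n ∸ j) !)
  ∎
  where
  open ≡-Reasoning
  instance _ = j ℕP.!* (n ∸ j) !≢0

Σ : ℕ → (ℕ → ℚ) → ℚ
Σ l f = sumFrom 0 l f

sumFrom-suc : ∀ a l f → sumFrom (suc a) l f ≡ sumFrom a l (λ i → f (suc i))
sumFrom-suc a zero    f = refl
sumFrom-suc a (suc l) f = cong (_+_ (f (suc a))) (sumFrom-suc (suc a) l f)

Σ-peel : ∀ l f → Σ (suc l) f ≡ f 0 + Σ l (λ i → f (suc i))
Σ-peel l f = cong (_+_ (f 0)) (sumFrom-suc 0 l f)

sumFrom-drop-zero : ∀ l f → f 0 ≡ 0ℚ → Σ (suc l) f ≡ sumFrom 1 l f
sumFrom-drop-zero l f f0≡0 = trans (cong (_+ sumFrom 1 l f) f0≡0) (+-identityˡ (sumFrom 1 l f))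

sumFrom-cong : ∀ a l {f g : ℕ → ℚ} → (∀ i → f i ≡ g i) → sumFrom a l f ≡ sumFrom a l g
sumFrom-cong a zero    f≡g = refl
sumFrom-cong a (suc l) f≡g = cong₂ _+_ (f≡g a) (sumFrom-cong (suc a) l f≡g)

sumFrom-cong-range : ∀ a l {f g : ℕ → ℚ} →
  (∀ i → a ≤ i → i < a ℕ.+ l → f i ≡ g i) → sumFrom a l f ≡ sumFrom a l g
sumFrom-cong-range a zero    f≡g = refl
sumFrom-cong-range a (suc l) f≡g =
  cong₂ _+_ (f≡g a ℕP.≤-refl (ℕP.m<m+n a (s≤s z≤n)))
            (sumFrom-cong-range (suc a) l (λ i a<i i<a+l →
              f≡g i (ℕP.<⇒≤ a<i) (subst (i <_) (sym (ℕP.+-suc a l)) i<a+l)))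

*-distribˡ-sumFrom : ∀ c a l f → c * sumFrom a l f ≡ sumFrom a l (λ i → c * f i)
*-distribˡ-sumFrom c a zero    f = *-zeroʳ c
*-distribˡ-sumFrom c a (suc l) f =
  trans (*-distribˡ-+ c (f a) _) (cong (_+_ (c * f a)) (*-distribˡ-sumFrom c (suc a) l f))

*-distribʳ-sumFrom : ∀ c a l f → sumFrom a l f * c ≡ sumFrom a l (λ i → f i * c)
*-distribʳ-sumFrom c a zero    f = *-zeroˡ c
*-distribʳ-sumFrom c a (suc l) f =
  trans (*-distribʳ-+ c (f a) _) (cong (_+_ (f a * c)) (*-distribʳ-sumFrom c (suc a) l f))

sumFrom-+ : ∀ a l f g → sumFrom a l (λ i → f i + g i) ≡ sumFrom a l f + sumFrom a l g
sumFrom-+ a zero    f g = sym (+-identityʳ 0ℚ)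
sumFrom-+ a (suc l) f g =
  trans (cong (_+_ (f a + g a)) (sumFrom-+ (suc a) l f g))
        (solve 4 (λ x y z w → (x :+ y) :+ (z :+ w) := (x :+ z) :+ (y :+ w)) refl (f a) (g a) _ _)

Σ-triangle-first-column : ∀ n (H : ℕ → ℕ → ℕ → ℚ) →
  Σ (suc (suc n)) (λ i → Σ (suc i) (λ l → H l (i ∸ l) (suc n ∸ i)))
  ≡ Σ (suc (suc n)) (λ p → H 0 p (suc n ∸ p))
    + Σ (suc n) (λ i → Σ (suc i) (λ l → H (suc l) (i ∸ l) (n ∸ i)))
Σ-triangle-first-column n H = begin
    Σ (suc (suc n)) g
  ≡⟨ Σ-peel (suc n) g ⟩
    g 0 + Σ (suc n) (λ i → g (suc i))
  ≡⟨ cong₂ _+_ (+-identityʳ (H 0 0 (suc n))) (sumFrom-cong 0 (suc n) (λ i → Σ-peel (suc i) (λ l → H l (suc i ∸ l) (n ∸ i)))) ⟩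
    H 0 0 (suc n) + Σ (suc n) (λ i → column i + rest i)
  ≡⟨ cong (_+_ (H 0 0 (suc n))) (sumFrom-+ 0 (suc n) column rest) ⟩
    H 0 0 (suc n) + (Σ (suc n) column + Σ (suc n) rest)
  ≡⟨ sym (+-assoc (H 0 0 (suc n)) _ _) ⟩
    (H 0 0 (suc n) + Σ (suc n) column) + Σ (suc n) rest
  ≡⟨ cong (_+ Σ (suc n) rest) (sym (Σ-peel (suc n) (λ p → H 0 p (suc n ∸ p)))) ⟩
    Σ (suc (suc n)) (λ p → H 0 p (suc n ∸ p)) + Σ (suc n) rest
  ∎
  where
  open ≡-Reasoning
  g column rest : ℕ → ℚ
  g i = Σ (suc i) (λ l → H l (i ∸ l) (suc n ∸ i))
  column i = H 0 (suc i) (n ∸ i)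
  rest i = Σ (suc i) (λ l → H (suc l) (i ∸ l) (n ∸ i))

-- Both sides sum H l p q over l + p + q = n; the left one groups by i = l + p.
Σ-triangle : ∀ n (H : ℕ → ℕ → ℕ → ℚ) →
  Σ (suc n) (λ i → Σ (suc i) (λ l → H l (i ∸ l) (n ∸ i)))
  ≡ Σ (suc n) (λ l → Σ (suc (n ∸ l)) (λ p → H l p (n ∸ l ∸ p)))
Σ-triangle zero    H = refl
Σ-triangle (suc n) H = begin
    Σ (suc (suc n)) (λ i → Σ (suc i) (λ l → H l (i ∸ l) (suc n ∸ i)))
  ≡⟨ Σ-triangle-first-column n H ⟩
    first + Σ (suc n) (λ i → Σ (suc i) (λ l → H (suc l) (i ∸ l) (n ∸ i)))
  ≡⟨ cong (_+_ first) (Σ-triangle n (λ l → H (suc l))) ⟩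
    first + Σ (suc n) (λ l → Σ (suc (n ∸ l)) (λ p → H (suc l) p (n ∸ l ∸ p)))
  ≡⟨ sym (Σ-peel (suc n) (λ l → Σ (suc (suc n ∸ l)) (λ p → H l p (suc n ∸ l ∸ p)))) ⟩
    Σ (suc (suc n)) (λ l → Σ (suc (suc n ∸ l)) (λ p → H l p (suc n ∸ l ∸ p)))
  ∎
  where
  open ≡-Reasoning
  first : ℚ
  first = Σ (suc (suc n)) (λ p → H 0 p (suc n ∸ p))

⊛-assoc : ∀ (f g h : Series) n → ((f ⊛ g) ⊛ h) n ≡ (f ⊛ (g ⊛ h)) n
⊛-assoc f g h n = begin
    Σ (suc n) (λ i → Σ (suc i) (λ l → f l * g (i ∸ l)) * h (n ∸ i))
  ≡⟨ sumFrom-cong 0 (suc n) (λ i → *-distribʳ-sumFrom (h (n ∸ i)) 0 (suc i) (λ l → f l * g (i ∸ l))) ⟩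
    Σ (suc n) (λ i → Σ (suc i) (λ l → f l * g (i ∸ l) * h (n ∸ i)))
  ≡⟨ Σ-triangle n (λ l p q → f l * g p * h q) ⟩
    Σ (suc n) (λ l → Σ (suc (n ∸ l)) (λ p → f l * g p * h (n ∸ l ∸ p)))
  ≡⟨ sumFrom-cong 0 (suc n) (λ l →
       trans (sumFrom-cong 0 (suc (n ∸ l)) (λ p → *-assoc (f l) _ _))
             (sym (*-distribˡ-sumFrom (f l) 0 (suc (n ∸ l)) (λ p → g p * h (n ∸ l ∸ p))))) ⟩
    Σ (suc n) (λ l → f l * Σ (suc (n ∸ l)) (λ p → g p * h (n ∸ l ∸ p)))
  ∎
  where open ≡-Reasoning

compose-from-1 : ∀ a u n → a 0 ≡ 0ℚ → compose a u n ≡ sumFrom 1 n (λ m → a m * (u ^ₛ m) n)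
compose-from-1 a u n a0≡0 =
  sumFrom-drop-zero n (λ m → a m * (u ^ₛ m) n) (trans (cong (_* (u ^ₛ 0) n) a0≡0) (*-zeroˡ ((u ^ₛ 0) n)))

module _ (k : ℤ) (n : ℕ) (x : ℚ) where

  Ei∘log eulerExp : Series
  Ei∘log   = compose (EiCoeff k) logS
  eulerExp = eulerGF ⊛ expS x

  summand : ℕ → ℕ → ℚ
  summand j m = nat (n C j) * S₁ j m * recipPow m (k -ℤ + 1) * E (n ∸ j) x

  Ei∘log-coefficient : ∀ j → Ei∘log j ≡ sumFrom 1 j (λ m → EiCoeff k m * (logS ^ₛ m) j)
  Ei∘log-coefficient j = compose-from-1 (EiCoeff k) logS j refl

  summand-from-coefficients : ∀ j m → 1 ≤ m → j ≤ n →
    nat (n !) * (EiCoeff k m * (logS ^ₛ m) j * eulerExp (n ∸ j)) ≡ summand j m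
  summand-from-coefficients j (suc m) _ j≤n = begin
      nat (n !) * (EiCoeff k (suc m) * logPow * eulerPart)
    ≡⟨ cong₂ (λ u v → u * (v * logPow * eulerPart)) (nat-!≡C*!*! n j j≤n) (EiCoeff-suc k m) ⟩
      nat (n C j) * nat (j !) * nat ((n ∸ j) !) * (invFact (suc m) * power * logPow * eulerPart)
    ≡⟨ solve 7 (λ c jf nf i r p b → c :* jf :* nf :* (i :* r :* p :* b)
                                  := c :* (jf :* i :* p) :* r :* (nf :* b))
         refl (nat (n C j)) (nat (j !)) (nat ((n ∸ j) !)) (invFact (suc m)) power logPow eulerPart ⟩
      summand j (suc m)
    ∎
    where
    open ≡-Reasoning
    logPow eulerPart power : ℚ
    logPow    = (logS ^ₛ suc m) j
    eulerPart = eulerExp (n ∸ j)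
    power     = recipPow (suc m) (k -ℤ + 1)

  term-from-coefficients : ∀ j → j ≤ n →
    nat (n !) * (Ei∘log j * eulerExp (n ∸ j)) ≡ sumFrom 1 j (summand j)
  term-from-coefficients j j≤n = begin
      nat (n !) * (Ei∘log j * eulerPart)
    ≡⟨ cong (λ a → nat (n !) * (a * eulerPart)) (Ei∘log-coefficient j) ⟩
      nat (n !) * (sumFrom 1 j c * eulerPart)
    ≡⟨ cong (nat (n !) *_) (*-distribʳ-sumFrom eulerPart 1 j c) ⟩
      nat (n !) * sumFrom 1 j (λ m → c m * eulerPart)
    ≡⟨ *-distribˡ-sumFrom (nat (n !)) 1 j (λ m → c m * eulerPart) ⟩
      sumFrom 1 j (λ m → nat (n !) * (c m * eulerPart))
    ≡⟨ sumFrom-cong-range 1 j (λ m 1≤m _ → summand-from-coefficients j m 1≤m j≤n) ⟩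
      sumFrom 1 j (summand j)
    ∎
    where
    open ≡-Reasoning
    eulerPart : ℚ
    eulerPart = eulerExp (n ∸ j)
    c : ℕ → ℚ
    c m = EiCoeff k m * (logS ^ₛ m) j

  G-expansion : G k n x ≡ sumFrom 1 n (λ j → sumFrom 1 j (summand j))
  G-expansion = begin
      nat (n !) * ((Ei∘log ⊛ eulerGF) ⊛ expS x) n
    ≡⟨ cong (nat (n !) *_) (⊛-assoc Ei∘log eulerGF (expS x) n) ⟩
      nat (n !) * Σ (suc n) term
    ≡⟨ cong (nat (n !) *_) (sumFrom-drop-zero n term
         (trans (cong (_* eulerExp n) (Ei∘log-coefficient 0)) (*-zeroˡ (eulerExp n)))) ⟩
      nat (n !) * sumFrom 1 n term
    ≡⟨ *-distribˡ-sumFrom (nat (n !)) 1 n term ⟩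
      sumFrom 1 n (λ j → nat (n !) * term j)
    ≡⟨ sumFrom-cong-range 1 n (λ j _ j<1+n → term-from-coefficients j (s≤s⁻¹ j<1+n)) ⟩
      sumFrom 1 n (λ j → sumFrom 1 j (summand j))
    ∎
    where
    open ≡-Reasoning
    term : ℕ → ℚ
    term j = Ei∘log j * eulerExp (n ∸ j)

theorem3 : (k : ℤ) (n : ℕ) .{{_ : NonZero n}} (x : ℚ) →
    polyE k (n ∸ 1) x
      ≡ ((+ 1) / n)
        * sumRange 1 n (λ j → sumRange 1 j (λ m →
            nat (n C j) * S₁ j m * recipPow m (k -ℤ + 1) * E (n ∸ j) x))
theorem3 k (suc n) x =
  trans (*-comm (G k (suc n) x) ((+ 1) / suc n))
        (cong (((+ 1) / suc n) *_) (G-expansion k (suc n) x))
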